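{- Let $(\mathscr A,\preceq,\multimap)$ be an implicative structure and $S$ a linear separator, and work in the quotient $\mathscr A/\dashv\vdash_S$ with the induced operations $[a]\multimap[b]=[a\multimap b]$, $[a]\otimes[b]=[a\otimes b]$ and the induced order $[a]\vdash_S[b]$ iff $a\vdash_S b$. Then for all $a,b,c,d\in\mathscr A$: (1) $[a]\otimes[b]=[b]\otimes[a]$; (2) $([a]\otimes[b])\otimes[c]=[a]\otimes([b]\otimes[c])$; (3) $[a]\otimes[\mathbf I^{\mathscr A}]=[a]$; (4) $([a]\otimes[b])\multimap[c]=[a]\multimap([b]\multimap[c])$; (5) $([a]\multimap[b])\otimes[a]\vdash_S[b]$; (6) $[a]\vdash_S[b]\multimap([a]\otimes[b])$; (7) $([a]\multimap[b])\otimes([b]\multimap[c])\vdash_S[a]\multimap[c]$; (8) $([a]\multimap[b])\otimes([c]\multimap[d])\vdash_S([a]\otimes[c])\multimap([b]\otimes[d])$.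
   Context: An implicative structure is a complete lattice $(\mathscr A,\preceq)$ with binary $\multimap$ (right-associative) such that $a'\preceq a$, $b\preceq b'$ imply $(a\multimap b)\preceq(a'\multimap b')$, and $a\multimap\bigwedge_{b\in B}b=\bigwedge_{b\in B}(a\multimap b)$. Set $a\otimes b:=\bigwedge_{c}((a\multimap b\multimap c)\multimap c)$ and $\mathbf I^{\mathscr A}:=\bigwedge_a(a\multimap a)$. A linear separator is a subset $S$ that is upward closed, closed under modus ponens ($a\in S$, $(a\multimap b)\in S$ imply $b\in S$), and contains $\mathbf I^{\mathscr A}$, $\bigwedge_{a,b,c}((b\multimap c)\multimap(a\multimap b)\multimap a\multimap c)$, $\bigwedge_{a,b,c}((a\multimap b\multimap c)\multimap b\multimap a\multimap c)$. Entailment: $a\vdash_S b$ iff $(a\multimap b)\in S$; $\dashv\vdash_S$ is the induced equivalence and $[a]$ the class of $a$; $\multimap$ and $\otimes$ are well defined on classes. -}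

module Defs where

open import Level using (Level; suc; _⊔_)
open import Data.Product using (_×_; _,_)
open import Relation.Binary.PropositionalEquality using (_≡_)
open import Relation.Binary.Structures using (IsPartialOrder)

-- An implicative structure: a complete lattice (A, ≼) given by arbitrary
-- meets of families indexed by types of level ℓ (this includes subsets of A,
-- taking as index type the Σ-type of elements satisfying a predicate), with a
-- binary implication ⊸ that is anti/monotone and commutes with arbitrary
-- meets in its second argument.
record ImplicativeStructure (ℓ : Level) : Set (suc ℓ) where
  infixr 5 _⊸_
  infix  4 _≼_
  field
    Carrier    : Set ℓ
    _≼_        : Carrier → Carrier → Set ℓ
    isPartialOrder : IsPartialOrder _≡_ _≼_
    ⋀          : {I : Set ℓ} → (I → Carrier) → Carrier
    ⋀-lower    : {I : Set ℓ} (f : I → Carrier) (i : I) → ⋀ f ≼ f i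
    ⋀-greatest : {I : Set ℓ} (f : I → Carrier) (x : Carrier) →
                 ((i : I) → x ≼ f i) → x ≼ ⋀ f
    _⊸_        : Carrier → Carrier → Carrier
    ⊸-mono     : ∀ {a a′ b b′} → a′ ≼ a → b ≼ b′ → (a ⊸ b) ≼ (a′ ⊸ b′)
    ⊸-⋀        : (a : Carrier) {I : Set ℓ} (f : I → Carrier) →
                 (a ⊸ ⋀ f) ≡ ⋀ (λ i → a ⊸ f i)

  infixr 6 _⊗_
  _⊗_ : Carrier → Carrier → Carrier
  a ⊗ b = ⋀ (λ c → (a ⊸ b ⊸ c) ⊸ c)

  𝐈 : Carrier
  𝐈 = ⋀ (λ a → a ⊸ a)

  𝐁 : Carrier
  𝐁 = ⋀ (λ (t : Carrier × Carrier × Carrier) → let (a , b , c) = t in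
          (b ⊸ c) ⊸ (a ⊸ b) ⊸ a ⊸ c)

  𝐂 : Carrier
  𝐂 = ⋀ (λ (t : Carrier × Carrier × Carrier) → let (a , b , c) = t in
          (a ⊸ b ⊸ c) ⊸ b ⊸ a ⊸ c)

  record IsLinearSeparator (S : Carrier → Set ℓ) : Set ℓ where
    field
      upward : ∀ {a b} → a ≼ b → S a → S b
      mp     : ∀ {a b} → S a → S (a ⊸ b) → S b
      has-I  : S 𝐈
      has-B  : S 𝐁
      has-C  : S 𝐂

  -- Entailment and the induced equivalence (equality of classes in A/⊣⊢_S).
  _⊢[_]_ : Carrier → (Carrier → Set ℓ) → Carrier → Set ℓ
  a ⊢[ S ] b = S (a ⊸ b)

  _⊣⊢[_]_ : Carrier → (Carrier → Set ℓ) → Carrier → Set ℓ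
  a ⊣⊢[ S ] b = (a ⊢[ S ] b) × (b ⊢[ S ] a)

-- Read ⊸ as linear implication and S as the set of provable formulas: the
-- instances of I, B and C in S together with modus ponens give the deduction
-- theorem for a linear (exchange-only) natural deduction calculus whose
-- judgement Γ ⊩ A means S (Γ₁ ⊸ ⋯ ⊸ Γₙ ⊸ A).  Tensor introduction needs a
-- single element of S below ⋀_c (a ⊸ b ⊸ (a ⊸ b ⊸ c) ⊸ c), since S is not
-- closed under meets; the combinator B C (C I) = λxyf. f x y is such an
-- element.
module Submission where

open import Defs
open import Level using (Level)
open import Data.Product using (Σ; _×_; _,_; proj₁; proj₂)
open import Data.List using (List; []; _∷_; [_]; _++_; _∷ʳ_; foldr)
open import Data.List.Properties using (foldr-++)
open import Relation.Binary.PropositionalEquality using (_≡_; sym; trans; cong; subst)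
open import Relation.Binary.Structures using (IsPartialOrder)

module Combinators {ℓ : Level} (𝒜 : ImplicativeStructure ℓ) where
  open ImplicativeStructure 𝒜
  open IsPartialOrder isPartialOrder using () renaming (refl to ≼-refl; trans to ≼-trans)

  infixl 7 _·_

  _·_ : Carrier → Carrier → Carrier
  t · u = ⋀ {Σ Carrier (λ c → t ≼ u ⊸ c)} proj₁

  ·-adjoint : ∀ t u → t ≼ u ⊸ t · u
  ·-adjoint t u = subst (t ≼_) (sym (⊸-⋀ u proj₁)) (⋀-greatest _ t proj₂)

  ·-least : ∀ {t u a b} → t ≼ a ⊸ b → u ≼ a → t · u ≼ b
  ·-least {b = b} t≼a⊸b u≼a = ⋀-lower _ (b , ≼-trans t≼a⊸b (⊸-mono u≼a ≼-refl))

  𝐈-lower : ∀ a → 𝐈 ≼ a ⊸ a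
  𝐈-lower a = ⋀-lower (λ a → a ⊸ a) a

  𝐁-lower : ∀ a b c → 𝐁 ≼ (b ⊸ c) ⊸ (a ⊸ b) ⊸ a ⊸ c
  𝐁-lower a b c = ⋀-lower _ (a , b , c)

  𝐂-lower : ∀ a b c → 𝐂 ≼ (a ⊸ b ⊸ c) ⊸ b ⊸ a ⊸ c
  𝐂-lower a b c = ⋀-lower _ (a , b , c)

  pairing : Carrier
  pairing = 𝐁 · 𝐂 · (𝐂 · 𝐈)

  pairing-lower : ∀ a b c → pairing ≼ a ⊸ b ⊸ (a ⊸ b ⊸ c) ⊸ c
  pairing-lower a b c =
    ·-least (·-least (𝐁-lower a (f ⊸ b ⊸ c) (b ⊸ f ⊸ c)) (𝐂-lower f b c))
            (·-least (𝐂-lower f a (b ⊸ c)) (𝐈-lower f))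
    where f = a ⊸ b ⊸ c

  ⊸⊸-⊗ : ∀ a b → (a ⊸ b ⊸ a ⊗ b) ≡ ⋀ (λ c → a ⊸ b ⊸ (a ⊸ b ⊸ c) ⊸ c)
  ⊸⊸-⊗ a b = trans (cong (a ⊸_) (⊸-⋀ b _)) (⊸-⋀ a _)

  pairing-lower-⊗ : ∀ a b → pairing ≼ a ⊸ b ⊸ a ⊗ b
  pairing-lower-⊗ a b =
    subst (pairing ≼_) (sym (⊸⊸-⊗ a b)) (⋀-greatest _ pairing (pairing-lower a b))

module LinearLogic {ℓ : Level} (𝒜 : ImplicativeStructure ℓ)
                   (S : ImplicativeStructure.Carrier 𝒜 → Set ℓ)
                   (sep : ImplicativeStructure.IsLinearSeparator 𝒜 S) where
  open ImplicativeStructure 𝒜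
  open IsLinearSeparator sep
  open IsPartialOrder isPartialOrder using () renaming (refl to ≼-refl; trans to ≼-trans)
  open Combinators 𝒜

  ·-closed : ∀ {t u} → S t → S u → S (t · u)
  ·-closed {t} {u} St Su = mp Su (upward (·-adjoint t u) St)

  ⊢-refl : ∀ {a} → a ⊢[ S ] a
  ⊢-refl {a} = upward (𝐈-lower a) has-I

  ≼⇒⊢ : ∀ {a b} → a ≼ b → a ⊢[ S ] b
  ≼⇒⊢ {a} a≼b = upward (≼-trans (𝐈-lower a) (⊸-mono ≼-refl a≼b)) has-I

  S-𝐁 : ∀ {a b c} → S ((b ⊸ c) ⊸ (a ⊸ b) ⊸ a ⊸ c)
  S-𝐁 {a} {b} {c} = upward (𝐁-lower a b c) has-B

  S-𝐂 : ∀ {a b c} → S ((a ⊸ b ⊸ c) ⊸ b ⊸ a ⊸ c)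
  S-𝐂 {a} {b} {c} = upward (𝐂-lower a b c) has-C

  pair : ∀ {a b} → a ⊢[ S ] (b ⊸ a ⊗ b)
  pair {a} {b} =
    upward (pairing-lower-⊗ a b) (·-closed (·-closed has-B has-C) (·-closed has-C has-I))

  ⊢-trans : ∀ {a b c} → a ⊢[ S ] b → b ⊢[ S ] c → a ⊢[ S ] c
  ⊢-trans a⊢b b⊢c = mp a⊢b (mp b⊢c S-𝐁)

  infixr 5 _⊸*_
  infix  2 _⊩_

  _⊸*_ : List Carrier → Carrier → Carrier
  Γ ⊸* a = foldr _⊸_ a Γ

  ⊸*-++ : ∀ Γ Δ a → (Γ ++ Δ) ⊸* a ≡ Γ ⊸* Δ ⊸* a
  ⊸*-++ Γ Δ a = foldr-++ _⊸_ a Γ Δ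

  ⊸*-map : ∀ Γ {a b} → a ⊢[ S ] b → (Γ ⊸* a) ⊢[ S ] (Γ ⊸* b)
  ⊸*-map []      a⊢b = a⊢b
  ⊸*-map (_ ∷ Γ) a⊢b = mp (⊸*-map Γ a⊢b) S-𝐁

  ⊸*-flip : ∀ Δ {a b} → (Δ ⊸* a ⊸ b) ⊢[ S ] (a ⊸ Δ ⊸* b)
  ⊸*-flip []      = ⊢-refl
  ⊸*-flip (_ ∷ Δ) = ⊢-trans (mp (⊸*-flip Δ) S-𝐁) S-𝐂

  ⊸*-apply : ∀ Δ {a b} → (Δ ⊸* a) ⊢[ S ] ((a ⊸ b) ⊸ Δ ⊸* b)
  ⊸*-apply Δ = ⊢-trans (⊸*-map Δ (mp ⊢-refl S-𝐂)) (⊸*-flip Δ)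

  record _⊩_ (Γ : List Carrier) (a : Carrier) : Set ℓ where
    constructor ⟨_⟩
    field derivation : S (Γ ⊸* a)
  open _⊩_ public

  split : ∀ Γ {Δ a} → Γ ++ Δ ⊩ a → S (Γ ⊸* Δ ⊸* a)
  split Γ {Δ} {a} ⟨ d ⟩ = subst S (⊸*-++ Γ Δ a) d

  join : ∀ Γ {Δ a} → S (Γ ⊸* Δ ⊸* a) → Γ ++ Δ ⊩ a
  join Γ {Δ} {a} d = ⟨ subst S (sym (⊸*-++ Γ Δ a)) d ⟩

  ⊩⇒⊢ : ∀ {a b} → [] ⊩ a ⊸ b → a ⊢[ S ] b
  ⊩⇒⊢ = derivation

  ax : ∀ {a} → [ a ] ⊩ a
  ax = ⟨ ⊢-refl ⟩

  ⊸-intro : ∀ {Γ a b} → Γ ∷ʳ a ⊩ b → Γ ⊩ a ⊸ b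
  ⊸-intro {Γ} d = ⟨ split Γ d ⟩

  ⊸-elim : ∀ {Γ Δ a b} → Γ ⊩ a ⊸ b → Δ ⊩ a → Γ ++ Δ ⊩ b
  ⊸-elim {Γ} {Δ} ⟨ d ⟩ ⟨ e ⟩ = join Γ (mp d (⊸*-map Γ (mp e (⊸*-apply Δ))))

  ⊸-elimʳ : ∀ {Γ Δ a b} → Γ ⊩ a → Δ ⊩ a ⊸ b → Γ ++ Δ ⊩ b
  ⊸-elimʳ {Γ} {Δ} ⟨ d ⟩ ⟨ e ⟩ = join Γ (mp d (⊸*-map Γ (mp e (⊸*-flip Δ))))

  exchange : ∀ Γ {Δ a b c} → Γ ++ a ∷ b ∷ Δ ⊩ c → Γ ++ b ∷ a ∷ Δ ⊩ c
  exchange Γ d = join Γ (mp (split Γ d) (⊸*-map Γ S-𝐂))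

  subsume : ∀ {Γ a b} → a ≼ b → Γ ⊩ a → Γ ⊩ b
  subsume {Γ} a≼b ⟨ d ⟩ = ⟨ mp d (⊸*-map Γ (≼⇒⊢ a≼b)) ⟩

  ⊗-intro : ∀ {Γ Δ a b} → Γ ⊩ a → Δ ⊩ b → Γ ++ Δ ⊩ a ⊗ b
  ⊗-intro d e = ⊸-elim (⊸-elim ⟨ pair ⟩ d) e

  ⊗-elim : ∀ {Γ Δ a b c} → Γ ⊩ a ⊗ b → Δ ⊩ a ⊸ b ⊸ c → Γ ++ Δ ⊩ c
  ⊗-elim {a = a} {b} {c} d e = ⊸-elim (subsume (⋀-lower (λ c → (a ⊸ b ⊸ c) ⊸ c) c) d) e

  ⊗-comm : ∀ {a b} → (a ⊗ b) ⊢[ S ] (b ⊗ a)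
  ⊗-comm = ⊩⇒⊢ (⊸-intro (⊗-elim ax (⊸-intro (⊸-intro (exchange [] (⊗-intro ax ax))))))

  ⊗-assocʳ : ∀ {a b c} → ((a ⊗ b) ⊗ c) ⊢[ S ] (a ⊗ (b ⊗ c))
  ⊗-assocʳ {a} = ⊩⇒⊢ (⊸-intro (⊗-elim ax (⊸-intro (⊸-intro (⊗-elim ax (⊸-intro (⊸-intro
    (exchange [] (exchange [ a ] (⊗-intro ax (⊗-intro ax ax)))))))))))

  ⊗-assocˡ : ∀ {a b c} → (a ⊗ (b ⊗ c)) ⊢[ S ] ((a ⊗ b) ⊗ c)
  ⊗-assocˡ = ⊩⇒⊢ (⊸-intro (⊗-elim ax (⊸-intro (⊸-intro (exchange [] (⊗-elim ax (⊸-intro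
    (⊸-intro (⊗-intro (⊗-intro ax ax) ax)))))))))

  ⊗-𝐈-elim : ∀ {a} → (a ⊗ 𝐈) ⊢[ S ] a
  ⊗-𝐈-elim {a} = ⊩⇒⊢ (⊸-intro (⊗-elim ax (⊸-intro (⊸-intro
    (⊸-elimʳ ax (subsume (𝐈-lower a) ax))))))

  ⊗-𝐈-intro : ∀ {a} → a ⊢[ S ] (a ⊗ 𝐈)
  ⊗-𝐈-intro = ⊩⇒⊢ (⊸-intro (⊗-intro ax ⟨ has-I ⟩))

  curry : ∀ {a b c} → ((a ⊗ b) ⊸ c) ⊢[ S ] (a ⊸ b ⊸ c)
  curry = ⊩⇒⊢ (⊸-intro (⊸-intro (⊸-intro (⊸-elim ax (⊗-intro ax ax)))))

  uncurry : ∀ {a b c} → (a ⊸ b ⊸ c) ⊢[ S ] ((a ⊗ b) ⊸ c)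
  uncurry = ⊩⇒⊢ (⊸-intro (⊸-intro (exchange [] (⊗-elim ax ax))))

  eval : ∀ {a b} → ((a ⊸ b) ⊗ a) ⊢[ S ] b
  eval = ⊩⇒⊢ (⊸-intro (⊗-elim ax (⊸-intro (⊸-intro (⊸-elim ax ax)))))

  compose : ∀ {a b c} → ((a ⊸ b) ⊗ (b ⊸ c)) ⊢[ S ] (a ⊸ c)
  compose = ⊩⇒⊢ (⊸-intro (⊸-intro (⊗-elim ax (⊸-intro (⊸-intro
    (⊸-elimʳ (⊸-elimʳ ax ax) ax))))))

  ⊗-map : ∀ {a b c d} → ((a ⊸ b) ⊗ (c ⊸ d)) ⊢[ S ] ((a ⊗ c) ⊸ (b ⊗ d))
  ⊗-map {a} {b} = ⊩⇒⊢ (⊸-intro (⊸-intro (⊗-elim ax (⊸-intro (⊸-intro (⊗-elim ax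
    (⊸-intro (⊸-intro (exchange [ a ⊸ b ] (⊗-intro (⊸-elim ax ax) (⊸-elim ax ax)))))))))))

proposition3p10 : {ℓ : Level} (𝒜 : ImplicativeStructure ℓ) →
    let open ImplicativeStructure 𝒜 in
    (S : Carrier → Set ℓ) → IsLinearSeparator S →
    (a b c d : Carrier) →
      ((a ⊗ b) ⊣⊢[ S ] (b ⊗ a))
    × (((a ⊗ b) ⊗ c) ⊣⊢[ S ] (a ⊗ (b ⊗ c)))
    × ((a ⊗ 𝐈) ⊣⊢[ S ] a)
    × (((a ⊗ b) ⊸ c) ⊣⊢[ S ] (a ⊸ (b ⊸ c)))
    × (((a ⊸ b) ⊗ a) ⊢[ S ] b)
    × (a ⊢[ S ] (b ⊸ (a ⊗ b)))
    × (((a ⊸ b) ⊗ (b ⊸ c)) ⊢[ S ] (a ⊸ c))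
    × (((a ⊸ b) ⊗ (c ⊸ d)) ⊢[ S ] ((a ⊗ c) ⊸ (b ⊗ d)))
proposition3p10 𝒜 S sep a b c d =
  (⊗-comm , ⊗-comm) , (⊗-assocʳ , ⊗-assocˡ) , (⊗-𝐈-elim , ⊗-𝐈-intro) , (curry , uncurry) ,
  eval , pair , compose , ⊗-map
  where open LinearLogic 𝒜 S sep
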